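{- Let $\mathfrak R$ be a finite nonempty $\mathtt{loc}$-deterministic set of P-rules satisfying (A1) and (A2). Let $\lambda$ be a symbolic heap and $(\mathfrak s,\mathfrak h)$ a pair with $(\mathfrak s,\mathfrak h)\models_{\mathfrak R}\lambda$. Then for every $\ell\in\mathit{ref}(\mathfrak h)$ there exists $x\in\mathit{alloc}(\lambda)$ such that $\mathfrak s(x)\to_{\mathfrak h}^*\ell$.
   Context: Syntax. There is a set of sorts containing a distinguished sort $\mathtt{loc}$. For each sort $s$ there is a countably infinite set $\mathcal V_s$ of variables (pairwise disjoint) and a set $\mathcal C_s$ of constants, with $\mathcal C_{\mathtt{loc}}=\emptyset$. Terms of sort $s$ are the elements of $\mathcal V_s\cup\mathcal C_s$. A pure formula is a finite conjunction of equations $t\approx u$ and disequations $t\not\approx u$ between terms of the same sort. Each predicate symbol $p$ has a profile $(s_1,\dots,s_n)$, $n\ge1$, $s_1=\mathtt{loc}$. A spatial atom is a points-to atom $x\mapsto(t_1,\dots,t_k)$ ($x\in\mathcal V_{\mathtt{loc}}$, $t_i$ terms) or a predicate atom $p(x,t_2,\dots,t_n)$ with $x\in\mathcal V_{\mathtt{loc}}$, $t_i$ of sort $s_i$; $x$ is the root. A spatial formula is a separating conjunction of spatial atoms modulo associativity/commutativity ($\mathit{emp}$ if empty). A symbolic heap is $\phi\curlywedge\xi$ with $\phi$ spatial and $\xi$ pure. $\mathit{alloc}(\lambda)$ is the multiset of roots of the spatial atoms of $\lambda$. An inductive rule is $p(x_1,\dots,x_n)\Leftarrow\lambda$ with pairwise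 distinct variables of the sorts of the profile of $p$ and $\lambda$ a symbolic heap; $p$ is its head. Semantics. Fix pairwise disjoint countably infinite sets $\mathfrak U_s$, $\mathfrak U=\bigcup_s\mathfrak U_s$, and an injective map $c\mapsto\dot c\in\mathfrak U_s$ on constants. A heap is a finite partial function from $\mathfrak U_{\mathtt{loc}}$ to finite tuples over $\mathfrak U$; $\uplus$ is union of heaps with disjoint domains. $\mathit{ref}(\mathfrak h)$ is the set of $\ell\in\mathfrak U_{\mathtt{loc}}$ such that for some $\ell_0\in\mathrm{dom}(\mathfrak h)$ with $\mathfrak h(\ell_0)=(\ell_1,\dots,\ell_n)$ we have $\ell=\ell_i$ for some $i\in\{0,\dots,n\}$. For $\ell,\ell'\in\mathfrak U_{\mathtt{loc}}$, $\ell\to_{\mathfrak h}\ell'$ iff $\ell\in\mathrm{dom}(\mathfrak h)$ and $\ell'$ is a component of $\mathfrak h(\ell)$; $\to_{\mathfrak h}^*$ is its reflexive–transitive closure. A store is a total sort-preserving map $\mathfrak s$ from terms to $\mathfrak U$ with $\mathfrak s(c)=\dot c$. $(\mathfrak s,\mathfrak h)\models_{\mathfrak R}\lambda$ is the least relation with: $\mathit{emp}$ iff $\mathfrak h=\emptyset$; $t\approx u$ / $t\not\approx u$ iff $\mathfrak s(t)=\mathfrak s(u)$ / $\ne$; $x\mapsto(t_1,\dots,t_k)$ iff $\mathfrak h$ is exactly the cell $\mathfrak s(x)\mapsto(\mathfrak s(t_1),\dots,\mathfrak s(t_k))$; conjunctions iff both conjuncts; $\lambda_1*\lambda_2$ iff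 $\mathfrak h=\mathfrak h_1\uplus\mathfrak h_2$ with $(\mathfrak s,\mathfrak h_i)\models_{\mathfrak R}\lambda_i$; $p(t_1,\dots,t_n)$ iff some rule $p(y_1,\dots,y_n)\Leftarrow\gamma$ of $\mathfrak R$ (renamed apart), with $\gamma'=\gamma\{y_i\leftarrow t_i\}$, and some store agreeing with $\mathfrak s$ outside the variables of $\gamma'$ not in $p(t_1,\dots,t_n)$, satisfy $\gamma'$ with heap $\mathfrak h$. P-rules. An inductive rule is a P-rule if it has the form $p(x_1,\dots,x_n)\Leftarrow x_1\mapsto(y_1,\dots,y_k)*q_1(z_1,\vec u_1)*\dots*q_m(z_m,\vec u_m)\curlywedge\xi$ ($m\ge0$, $y_i$ terms) where: (1) $\xi$ is a conjunction of disequations $u\not\approx v$ with $u\in\{x_1,..,x_n,y_1,..,y_k\}$, $v\in\{y_1,..,y_k\}\setminus\{x_1,..,x_n\}$; (2) $\{z_1,..,z_m\}=(\{y_1,..,y_k\}\setminus\{x_1,..,x_n\})\cap\mathcal V_{\mathtt{loc}}$ with the $z_j$ pairwise distinct; (3) every element of each $\vec u_i$ is in $\{x_1,..,x_n\}\cup\{y_1,..,y_k\}\cup\mathcal C$. (A1): every predicate symbol is productive (productive symbols: least set such that $p$ is productive if some rule with head $p$ has a body all of whose predicate symbols are productive). $\mathit{out}(p)$ is the least family of index sets such that $i\in\mathit{out}(p)$ if $s_i=\mathtt{loc}$ and some rule $p(x_1,\dots,x_n)\Leftarrow\lambda$ has $\lambda$ containing a points-to atom $x_1\mapsto(t_1,\dots,t_k)$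 with $x_i\in\{t_1,..,t_k\}$ or a predicate atom $q(t_1,\dots,t_m)$ with $t_j=x_i$, $j\in\mathit{out}(q)$. (A2): for each $p$ of profile $(\mathtt{loc},s_2,..,s_n)$, $\mathit{out}(p)\supseteq\{2\le i\le n\mid s_i=\mathtt{loc}\}$. A set of P-rules is $\mathtt{loc}$-deterministic if (i) for any two distinct rules $p(\vec x_i)\Leftarrow(y_i\mapsto\vec t_i*\phi_i)\curlywedge\xi_i$ ($i=1,2$) with the same head, renamed apart, $\vec x_1\approx\vec x_2\wedge\vec t_1\approx\vec t_2\wedge\xi_1\wedge\xi_2$ is unsatisfiable (tuple equations being false for tuples of different lengths or componentwise sorts), and (ii) every disequation in its rules is $x\not\approx y$ with $x,y\in\mathcal V_{\mathtt{loc}}$. -}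

module Defs where

open import Level using (0ℓ)
open import Data.Nat using (ℕ; zero; suc; _≤_)
open import Data.Maybe using (Maybe; just; nothing)
open import Data.Product using (Σ; ∃; ∃₂; _×_; _,_; proj₁)
open import Data.Sum using (_⊎_)
open import Data.Unit using (⊤)
open import Data.Empty using (⊥)
open import Data.List using (List; []; _∷_; map; _++_)
open import Data.List.Relation.Unary.All using (All; []; _∷_)
open import Data.List.Membership.Propositional using (_∈_; _∉_)
open import Data.List.Relation.Unary.Unique.Propositional using (Unique)
open import Data.List.Relation.Binary.Permutation.Propositional using (_↭_)
open import Relation.Nullary using (¬_)
open import Relation.Binary.PropositionalEquality using (_≡_; _≢_)
open import Relation.Binary.Construct.Closure.ReflexiveTransitive using (Star)

nth : ∀ {A : Set} → List A → ℕ → Maybe A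
nth []       _       = nothing
nth (x ∷ xs) zero    = just x
nth (x ∷ xs) (suc i) = nth xs i

-- A signature: sorts with distinguished sort loc, constants per sort
-- (no constants of sort loc), the injective map c ↦ ċ into 𝔘_s, and
-- predicate symbols whose profile is (loc , rest p).
record Sig : Set₁ where
  field
    Sort    : Set
    loc     : Sort
    Const   : Sort → Set
    noLocConst : ¬ Const loc
    dot     : ∀ {s} → Const s → ℕ
    dot-inj : ∀ {s} (c d : Const s) → dot c ≡ dot d → c ≡ d
    Pred    : Set
    rest    : Pred → List Sort

module SL (S : Sig) where
  open Sig S public

  profile : Pred → List Sort
  profile p = loc ∷ rest p

  data Term (s : Sort) : Set where
    var : ℕ → Term s
    con : Const s → Term s

  Var : Set
  Var = Σ Sort (λ _ → ℕ)

  STerm : Set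
  STerm = Σ Sort Term

  IsVar : ∀ {s} → Term s → Set
  IsVar (var _) = ⊤
  IsVar (con _) = ⊥

  IsConst : STerm → Set
  IsConst (_ , var _) = ⊥
  IsConst (_ , con _) = ⊤

  varTerm : Var → STerm
  varTerm (s , n) = s , var n

  data PAtom : Set where
    eqA  : (s : Sort) → Term s → Term s → PAtom
    neqA : (s : Sort) → Term s → Term s → PAtom

  toSTerms : ∀ {ss} → All Term ss → List STerm
  toSTerms []                = []
  toSTerms (_∷_ {x = s} t ts) = (s , t) ∷ toSTerms ts

  toVars : ∀ {ss} → All (λ _ → ℕ) ss → List Var
  toVars []                = []
  toVars (_∷_ {x = s} n ns) = (s , n) ∷ toVars ns

  data SAtom : Set where
    pto  : ℕ → List STerm → SAtom
    pred : (p : Pred) → ℕ → All Term (rest p) → SAtom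

  rootOf : SAtom → ℕ
  rootOf (pto x _)    = x
  rootOf (pred _ x _) = x

  IsPredAtom : SAtom → Set
  IsPredAtom (pto _ _)    = ⊥
  IsPredAtom (pred _ _ _) = ⊤

  argTerms : (p : Pred) → ℕ → All Term (rest p) → List STerm
  argTerms p x us = (loc , var x) ∷ toSTerms us

  predsOf : List SAtom → List Pred
  predsOf []                = []
  predsOf (pto _ _ ∷ as)    = predsOf as
  predsOf (pred p _ _ ∷ as) = p ∷ predsOf as

  -- symbolic heap  φ ⋏ ξ  (spatial part a list, read modulo AC)
  record SH : Set where
    constructor _⋏_
    field
      spatial : List SAtom
      pure    : List PAtom
  open SH public

  alloc : SH → List ℕ
  alloc l = map rootOf (spatial l)

  record Rule : Set where
    constructor rule
    field
      head   : Pred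
      root   : ℕ
      params : All (λ _ → ℕ) (rest head)
      body   : SH
  open Rule public

  hv : Rule → List Var
  hv r = (loc , root r) ∷ toVars (params r)

  headTerms : Rule → List STerm
  headTerms r = map varTerm (hv r)

  WellFormedRule : Rule → Set
  WellFormedRule r = Unique (hv r)

  -- Semantics: 𝔘_s = {s} × ℕ, so 𝔘 = Σ Sort (λ _ → ℕ); 𝔘_loc ≅ ℕ.
  Val : Set
  Val = Σ Sort (λ _ → ℕ)

  -- a store: total sort-preserving map on variables (constants c ↦ ċ)
  Store : Set
  Store = Sort → ℕ → ℕ

  evalT : Store → STerm → Val
  evalT st (s , var n) = s , st s n
  evalT st (s , con c) = s , dot c

  evalV : Store → Var → Val
  evalV st (s , n) = s , st s n

  record Heap : Set where
    field
      cell : ℕ → Maybe (List Val)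
      fin  : ∃ λ (dom : List ℕ) → ∀ l vs → cell l ≡ just vs → l ∈ dom
  open Heap public

  Emp : Heap → Set
  Emp h = ∀ l → cell h l ≡ nothing

  Split : Heap → Heap → Heap → Set
  Split h h1 h2 = ∀ l → (cell h1 l ≡ nothing × cell h l ≡ cell h2 l)
                      ⊎ (cell h2 l ≡ nothing × cell h l ≡ cell h1 l)

  SatP : Store → PAtom → Set
  SatP st (eqA s t u)  = evalT st (s , t) ≡ evalT st (s , u)
  SatP st (neqA s t u) = evalT st (s , t) ≢ evalT st (s , u)

  SatPs : Store → List PAtom → Set
  SatPs st ξ = All (SatP st) ξ

  mutual
    data SatA (R : List Rule) : Store → Heap → SAtom → Set where
      sat-pto : ∀ {st h x ts}
        → cell h (st loc x) ≡ just (map (evalT st) ts)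
        → (∀ l → l ≢ st loc x → cell h l ≡ nothing)
        → SatA R st h (pto x ts)
      sat-pred : ∀ {st h p x us} (r : Rule) → r ∈ R → head r ≡ p
        → (st' : Store)
        → map (evalV st') (hv r) ≡ map (evalT st) (argTerms p x us)
        → SatS R st' h (spatial (body r))
        → SatPs st' (pure (body r))
        → SatA R st h (pred p x us)

    data SatS (R : List Rule) : Store → Heap → List SAtom → Set where
      sat-emp : ∀ {st h} → Emp h → SatS R st h []
      sat-sep : ∀ {st h h1 h2 a φ} → Split h h1 h2
        → SatA R st h1 a → SatS R st h2 φ → SatS R st h (a ∷ φ)

  SatSH : List Rule → Store → Heap → SH → Set
  SatSH R st h l = SatS R st h (spatial l) × SatPs st (pure l)

  Ref : Heap → ℕ → Set
  Ref h l = ∃₂ λ l0 vs → cell h l0 ≡ just vs × (l ≡ l0 ⊎ (loc , l) ∈ vs)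

  Edge : Heap → ℕ → ℕ → Set
  Edge h l l' = ∃ λ vs → cell h l ≡ just vs × (loc , l') ∈ vs

  Reach : Heap → ℕ → ℕ → Set
  Reach h = Star (Edge h)

  PDiseq : Rule → List STerm → PAtom → Set
  PDiseq r ys (eqA _ _ _)  = ⊥
  PDiseq r ys (neqA s u v) =
    (s , u) ∈ (headTerms r ++ ys) × (s , v) ∈ ys × (s , v) ∉ headTerms r

  ArgsOK : Rule → List STerm → SAtom → Set
  ArgsOK r ys (pto _ _)     = ⊤
  ArgsOK r ys (pred q _ us) =
    All (λ t → t ∈ (headTerms r ++ ys) ⊎ IsConst t) (toSTerms us)

  IsPRule : Rule → Set
  IsPRule r = ∃₂ λ (ys : List STerm) (qs : List SAtom) →
      (spatial (body r) ↭ (pto (root r) ys ∷ qs))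
    × All IsPredAtom qs
    × All (PDiseq r ys) (pure (body r))
    × Unique (map rootOf qs)
    × (∀ z → (z ∈ map rootOf qs →
                 ((loc , var z) ∈ ys × (loc , var z) ∉ headTerms r))
           × (((loc , var z) ∈ ys × (loc , var z) ∉ headTerms r) →
                 z ∈ map rootOf qs))
    × All (ArgsOK r ys) qs

  data Productive (R : List Rule) : Pred → Set where
    prod : ∀ {r} → r ∈ R → All (Productive R) (predsOf (spatial (body r)))
         → Productive R (head r)

  A1 : List Rule → Set
  A1 R = ∀ p → Productive R p

  -- out(p), positions 0-based in the profile (position 0 = x1)
  data Out (R : List Rule) : Pred → ℕ → Set where
    out-pto : ∀ {r i x ts} → r ∈ R
      → nth (hv r) i ≡ just (loc , x)
      → pto (root r) ts ∈ spatial (body r)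
      → (loc , var x) ∈ ts
      → Out R (head r) i
    out-pred : ∀ {r i x q y us j} → r ∈ R
      → nth (hv r) i ≡ just (loc , x)
      → pred q y us ∈ spatial (body r)
      → nth (argTerms q y us) j ≡ just (loc , var x)
      → Out R q j
      → Out R (head r) i

  -- (A2): every position 2..n (0-based: ≥ 1) of sort loc is in out(p)
  A2 : List Rule → Set
  A2 R = ∀ p i → 1 ≤ i → nth (profile p) i ≡ just loc → Out R p i

  LocVarDiseq : PAtom → Set
  LocVarDiseq (eqA _ _ _)  = ⊤
  LocVarDiseq (neqA s u v) = s ≡ loc × IsVar u × IsVar v

  LocDeterministic : List Rule → Set
  LocDeterministic R =
    (∀ {r1 r2} → r1 ∈ R → r2 ∈ R → r1 ≢ r2 → head r1 ≡ head r2
      → ∀ {a1 ts1 a2 ts2}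
      → pto a1 ts1 ∈ spatial (body r1) → pto a2 ts2 ∈ spatial (body r2)
      → ∀ (st1 st2 : Store)
      → map (evalV st1) (hv r1) ≡ map (evalV st2) (hv r2)
      → map (evalT st1) ts1 ≡ map (evalT st2) ts2
      → SatPs st1 (pure (body r1)) → SatPs st2 (pure (body r2)) → ⊥)
    × (∀ {r} → r ∈ R → All LocVarDiseq (pure (body r)))

{-# OPTIONS --safe #-}
module Submission where

-- A points-to atom allocates exactly its root, and in the body of a P-rule the
-- root cell points to the roots of all the predicate atoms; so, by induction on
-- satisfaction, every cell of a model of p(x, …) is reachable from x. A
-- referenced location is allocated or stored in an allocated cell, hence
-- reachable one step further.

open import Defs
open import Data.List using (List; []; _∷_; map)
open import Data.List.Relation.Unary.All as All using (All)
open import Data.List.Relation.Unary.Any using (here; there)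
open import Data.List.Membership.Propositional using (_∈_)
open import Data.List.Membership.Propositional.Properties using (∈-map⁺)
open import Data.List.Relation.Binary.Permutation.Propositional using (_↭_; ↭-sym)
open import Data.List.Relation.Binary.Permutation.Propositional.Properties using (∈-resp-↭)
open import Data.List.Properties using (∷-injectiveˡ)
open import Data.Nat using (ℕ)
open import Data.Nat.Properties using (_≟_)
open import Data.Product using (∃; ∃₂; _×_; _,_; proj₁; proj₂)
open import Data.Sum using (_⊎_; inj₁; inj₂)
open import Data.Maybe using (just)
open import Data.Empty using (⊥-elim)
open import Relation.Nullary using (¬_; yes; no)
open import Relation.Binary.PropositionalEquality using (_≡_; _≢_; refl; sym; trans; cong; subst)
open import Relation.Binary.Construct.Closure.ReflexiveTransitive as Star using (ε; _◅_; _◅◅_)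

module Reachability (S : Sig) where
  open SL S

  record Dom (h : Heap) (l : ℕ) : Set where
    constructor dom
    field
      {contents} : List Val
      cell-just  : cell h l ≡ just contents

  record _⊆ʰ_ (h₁ h : Heap) : Set where
    field ⊆ʰ-cell : ∀ {l vs} → cell h₁ l ≡ just vs → cell h l ≡ just vs
  open _⊆ʰ_

  Emp⇒¬Dom : ∀ {h l} → Emp h → ¬ Dom h l
  Emp⇒¬Dom {l = l} e (dom c) with () ← trans (sym (e l)) c

  -- Split h h₁ h₂ unfolds to a Π-type, so its heaps cannot be inferred and are
  -- passed explicitly at use sites.
  Split⇒⊆ˡ : ∀ {h h₁ h₂} → Split h h₁ h₂ → h₁ ⊆ʰ h
  Split⇒⊆ˡ sp .⊆ʰ-cell {l} c with sp l
  ... | inj₁ (n , _) with () ← trans (sym n) c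
  ... | inj₂ (_ , e) = trans e c

  Split⇒⊆ʳ : ∀ {h h₁ h₂} → Split h h₁ h₂ → h₂ ⊆ʰ h
  Split⇒⊆ʳ sp .⊆ʰ-cell {l} c with sp l
  ... | inj₁ (_ , e) = trans e c
  ... | inj₂ (n , _) with () ← trans (sym n) c

  Split-Dom : ∀ {h h₁ h₂ l} → Split h h₁ h₂ → Dom h l → Dom h₁ l ⊎ Dom h₂ l
  Split-Dom {l = l} sp (dom c) with sp l
  ... | inj₁ (_ , e) = inj₂ (dom (trans (sym e) c))
  ... | inj₂ (_ , e) = inj₁ (dom (trans (sym e) c))

  Reach-mono : ∀ {h₁ h a b} → h₁ ⊆ʰ h → Reach h₁ a b → Reach h a b
  Reach-mono h₁⊆h = Star.map λ (vs , c , m) → vs , ⊆ʰ-cell h₁⊆h c , m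

  Ref⇒reachable-from-Dom : ∀ {h ℓ} → Ref h ℓ → ∃ λ l₀ → Dom h l₀ × Reach h l₀ ℓ
  Ref⇒reachable-from-Dom (l₀ , vs , c , inj₁ refl) = l₀ , dom c , ε
  Ref⇒reachable-from-Dom (l₀ , vs , c , inj₂ m)    = l₀ , dom c , (vs , c , m) ◅ ε

  sat-pto∈⇒cell : ∀ {R st h φ x ts} → SatS R st h φ → pto x ts ∈ φ
                → cell h (st loc x) ≡ just (map (evalT st) ts)
  sat-pto∈⇒cell (sat-sep {h = h} {h₁} {h₂} sp (sat-pto c _) _) (here refl) =
    ⊆ʰ-cell (Split⇒⊆ˡ {h} {h₁} {h₂} sp) c
  sat-pto∈⇒cell (sat-sep {h = h} {h₁} {h₂} sp _ sφ) (there m) =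
    ⊆ʰ-cell (Split⇒⊆ʳ {h} {h₁} {h₂} sp) (sat-pto∈⇒cell sφ m)

  sat-pto-Dom : ∀ {R st h x ts l} → SatA R st h (pto x ts) → Dom h l → l ≡ st loc x
  sat-pto-Dom {st = st} {x = x} {l = l} (sat-pto _ elsewhere) (dom c) with l ≟ st loc x
  ... | yes l≡x = l≡x
  ... | no  l≢x with () ← trans (sym (elsewhere l l≢x)) c

  hv-root : ∀ st r {v vs} → map (evalV st) (hv r) ≡ (loc , v) ∷ vs → st loc (root r) ≡ v
  hv-root _ _ heq = cong proj₂ (∷-injectiveˡ heq)

  -- All that the argument needs from a P-rule.
  RootedRule : Rule → Set
  RootedRule r = ∃₂ λ ys qs → spatial (body r) ↭ (pto (root r) ys ∷ qs)
                            × All (λ a → (loc , var (rootOf a)) ∈ ys) qs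

  IsPRule⇒RootedRule : ∀ {r} → IsPRule r → RootedRule r
  IsPRule⇒RootedRule (ys , qs , perm , _ , _ , _ , roots , _) =
    ys , qs , perm , All.tabulate λ {a} a∈qs → proj₁ (proj₁ (roots (rootOf a)) (∈-map⁺ rootOf a∈qs))

  root-reaches-atom-roots : ∀ {R st h r a} → RootedRule r → SatS R st h (spatial (body r))
                          → a ∈ spatial (body r) → Reach h (st loc (root r)) (st loc (rootOf a))
  root-reaches-atom-roots {st = st} (ys , qs , perm , pointed) sb a∈ with ∈-resp-↭ perm a∈
  ... | here refl = ε
  ... | there a∈qs = (_ , sat-pto∈⇒cell sb root∈ , ∈-map⁺ (evalT st) (All.lookup pointed a∈qs)) ◅ ε
    where root∈ = ∈-resp-↭ (↭-sym perm) (here refl)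

  module _ {R : List Rule} (rooted : All RootedRule R) where
    mutual
      Dom-reachable-from-rootᴬ : ∀ {st h a l} → SatA R st h a → Dom h l
                               → Reach h (st loc (rootOf a)) l
      Dom-reachable-from-rootᴬ s@(sat-pto _ _) d rewrite sat-pto-Dom s d = ε
      Dom-reachable-from-rootᴬ {h = h} {l = l} (sat-pred r r∈R refl st′ heq sb _) d
        with a , a∈ , a⇝l ← Dom-reachable-from-rootˢ sb d =
        subst (λ v → Reach h v l) (hv-root st′ r heq)
              (root-reaches-atom-roots {r = r} (All.lookup rooted r∈R) sb a∈ ◅◅ a⇝l)

      Dom-reachable-from-rootˢ : ∀ {st h φ l} → SatS R st h φ → Dom h l
                               → ∃ λ a → a ∈ φ × Reach h (st loc (rootOf a)) l
      Dom-reachable-from-rootˢ (sat-emp e) d = ⊥-elim (Emp⇒¬Dom e d)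
      Dom-reachable-from-rootˢ (sat-sep {h = h} {h₁} {h₂} sp sa sφ) d
        with Split-Dom {h} {h₁} {h₂} sp d
      ... | inj₁ d₁ = _ , here refl ,
        Reach-mono (Split⇒⊆ˡ {h} {h₁} {h₂} sp) (Dom-reachable-from-rootᴬ sa d₁)
      ... | inj₂ d₂ with a , a∈ , a⇝l ← Dom-reachable-from-rootˢ sφ d₂ =
        a , there a∈ , Reach-mono (Split⇒⊆ʳ {h} {h₁} {h₂} sp) a⇝l

    Ref-reachable-from-alloc : ∀ {st h φ ℓ} → SatS R st h φ → Ref h ℓ
                             → ∃ λ x → x ∈ map rootOf φ × Reach h (st loc x) ℓ
    Ref-reachable-from-alloc sφ ref
      with l₀ , d , l₀⇝ℓ ← Ref⇒reachable-from-Dom ref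
      with a , a∈ , a⇝l₀ ← Dom-reachable-from-rootˢ sφ d =
      rootOf a , ∈-map⁺ rootOf a∈ , a⇝l₀ ◅◅ l₀⇝ℓ

proposition6 : (S : Sig) → let open SL S in
    (R : List Rule) → R ≢ [] → All WellFormedRule R → All IsPRule R
    → LocDeterministic R → A1 R → A2 R
    → (l : SH) (st : Store) (h : Heap) → SatSH R st h l
    → ∀ (ℓ : ℕ) → Ref h ℓ → ∃ λ (x : ℕ) → x ∈ alloc l × Reach h (st loc x) ℓ
proposition6 S R _ _ pRules _ _ _ _ _ _ (sat , _) _ =
  Ref-reachable-from-alloc (All.map IsPRule⇒RootedRule pRules) sat
  where open Reachability S
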